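{- Let $\mathcal{C}$ be a cd-category with normalisation. Then for every morphism $f$, $\mathrm{norm}(f)$ is the minimal normalisation of $f$.
   Context: A cd-category is a symmetric monoidal category $(\mathcal{C},\otimes,I)$ (symmetry $\sigma$) in which every object $X$ carries $\Delta_X\colon X\to X\otimes X$ and $\epsilon_X\colon X\to I$ forming a commutative comonoid, compatible with the tensor. For $f,g\colon X\to Y$, $g$ normalises $f$ if $f=(g\otimes(\epsilon_Y\circ f))\circ\Delta_X$; $g$ is a partial channel if it normalises itself. A minimal normalisation of $f$ is a partial channel $f'$ that normalises $f$ and such that every partial channel $g$ that normalises $f$ also normalises $f'$. Normalisation on $\mathcal{C}$: an assignment to each $f\colon X\to Y$ of a partial channel $\mathrm{norm}(f)\colon X\to Y$ that normalises $f$, such that (N1) $\mathrm{norm}(f)=f$ when $f$ is a partial channel; (N2) $\mathrm{norm}(f\otimes g)=\mathrm{norm}(f)\otimes\mathrm{norm}(g)$; (N3) $\mathrm{norm}(\epsilon_Y\circ f)=\epsilon_Y\circ\mathrm{norm}(f)$; (N4) $\mathrm{norm}(f\circ\Delta_X)=\mathrm{norm}(f)\circ\Delta_X$ for all $f\colon X\otimes X\to Y$. -}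

module Defs where

open import Level using (Level; _⊔_) renaming (suc to lsuc)
open import Relation.Binary.PropositionalEquality using (_≡_)
open import Data.Product using (_×_)

record CDCategory (o ℓ : Level) : Set (lsuc (o ⊔ ℓ)) where
  infixr 9 _∘_
  infixr 10 _⊗₀_ _⊗₁_
  field
    Obj : Set o
    Hom : Obj → Obj → Set ℓ
    id  : ∀ {A} → Hom A A
    _∘_ : ∀ {A B C} → Hom B C → Hom A B → Hom A C
    assoc : ∀ {A B C D} (f : Hom A B) (g : Hom B C) (h : Hom C D) →
            (h ∘ g) ∘ f ≡ h ∘ (g ∘ f)
    identityˡ : ∀ {A B} (f : Hom A B) → id ∘ f ≡ f
    identityʳ : ∀ {A B} (f : Hom A B) → f ∘ id ≡ f

    _⊗₀_ : Obj → Obj → Obj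
    _⊗₁_ : ∀ {A B C D} → Hom A B → Hom C D → Hom (A ⊗₀ C) (B ⊗₀ D)
    I : Obj
    ⊗-id : ∀ {A B} → id {A} ⊗₁ id {B} ≡ id
    ⊗-∘ : ∀ {A B C D E F} (f : Hom B C) (g : Hom A B) (h : Hom E F) (k : Hom D E) →
          (f ∘ g) ⊗₁ (h ∘ k) ≡ (f ⊗₁ h) ∘ (g ⊗₁ k)

    α⇒ : ∀ {A B C} → Hom ((A ⊗₀ B) ⊗₀ C) (A ⊗₀ (B ⊗₀ C))
    α⇐ : ∀ {A B C} → Hom (A ⊗₀ (B ⊗₀ C)) ((A ⊗₀ B) ⊗₀ C)
    α-isoˡ : ∀ {A B C} → α⇐ {A} {B} {C} ∘ α⇒ ≡ id
    α-isoʳ : ∀ {A B C} → α⇒ {A} {B} {C} ∘ α⇐ ≡ id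
    α-natural : ∀ {A B C D E F} (f : Hom A D) (g : Hom B E) (h : Hom C F) →
                α⇒ ∘ ((f ⊗₁ g) ⊗₁ h) ≡ (f ⊗₁ (g ⊗₁ h)) ∘ α⇒

    λ⇒ : ∀ {A} → Hom (I ⊗₀ A) A
    λ⇐ : ∀ {A} → Hom A (I ⊗₀ A)
    λ-isoˡ : ∀ {A} → λ⇐ {A} ∘ λ⇒ ≡ id
    λ-isoʳ : ∀ {A} → λ⇒ {A} ∘ λ⇐ ≡ id
    λ-natural : ∀ {A B} (f : Hom A B) → λ⇒ ∘ (id ⊗₁ f) ≡ f ∘ λ⇒

    ρ⇒ : ∀ {A} → Hom (A ⊗₀ I) A
    ρ⇐ : ∀ {A} → Hom A (A ⊗₀ I)
    ρ-isoˡ : ∀ {A} → ρ⇐ {A} ∘ ρ⇒ ≡ id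
    ρ-isoʳ : ∀ {A} → ρ⇒ {A} ∘ ρ⇐ ≡ id
    ρ-natural : ∀ {A B} (f : Hom A B) → ρ⇒ ∘ (f ⊗₁ id) ≡ f ∘ ρ⇒

    pentagon : ∀ {A B C D} →
               (id {A} ⊗₁ α⇒ {B} {C} {D}) ∘ α⇒ ∘ (α⇒ ⊗₁ id) ≡ α⇒ ∘ α⇒
    triangle : ∀ {A B} → (id {A} ⊗₁ λ⇒ {B}) ∘ α⇒ ≡ ρ⇒ ⊗₁ id

    σ : ∀ {A B} → Hom (A ⊗₀ B) (B ⊗₀ A)
    σ-inv : ∀ {A B} → σ {B} {A} ∘ σ {A} {B} ≡ id
    σ-natural : ∀ {A B C D} (f : Hom A B) (g : Hom C D) →
                σ ∘ (f ⊗₁ g) ≡ (g ⊗₁ f) ∘ σ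
    hexagon : ∀ {A B C} →
              α⇒ {B} {C} {A} ∘ σ {A} {B ⊗₀ C} ∘ α⇒ {A} {B} {C}
              ≡ (id ⊗₁ σ) ∘ α⇒ ∘ (σ ⊗₁ id)

    Δ : ∀ {A} → Hom A (A ⊗₀ A)
    ε : ∀ {A} → Hom A I
    Δ-coassoc : ∀ {A} → α⇒ ∘ (Δ ⊗₁ id) ∘ Δ ≡ (id ⊗₁ Δ) ∘ Δ {A}
    Δ-counitˡ : ∀ {A} → λ⇒ ∘ (ε ⊗₁ id) ∘ Δ ≡ id {A}
    Δ-counitʳ : ∀ {A} → ρ⇒ ∘ (id ⊗₁ ε) ∘ Δ ≡ id {A}
    Δ-comm : ∀ {A} → σ ∘ Δ {A} ≡ Δ

    ε-⊗ : ∀ {A B} → ε {A ⊗₀ B} ≡ λ⇒ ∘ (ε {A} ⊗₁ ε {B})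
    ε-I : ε {I} ≡ id
    Δ-⊗ : ∀ {A B} →
          Δ {A ⊗₀ B} ≡ α⇐ ∘ (id ⊗₁ α⇒) ∘ (id ⊗₁ (σ ⊗₁ id)) ∘ (id ⊗₁ α⇐) ∘ α⇒
                       ∘ (Δ {A} ⊗₁ Δ {B})
    Δ-I : Δ {I} ≡ λ⇐

module _ {o ℓ} (C : CDCategory o ℓ) where
  open CDCategory C

  Normalises : ∀ {X Y} → Hom X Y → Hom X Y → Set ℓ
  Normalises {X} {Y} g f = f ≡ ρ⇒ ∘ (g ⊗₁ (ε {Y} ∘ f)) ∘ Δ {X}

  PartialChannel : ∀ {X Y} → Hom X Y → Set ℓ
  PartialChannel g = Normalises g g

  IsMinimalNormalisation : ∀ {X Y} → Hom X Y → Hom X Y → Set ℓ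
  IsMinimalNormalisation {X} {Y} f f′ =
    PartialChannel f′ × Normalises f′ f ×
    (∀ (g : Hom X Y) → PartialChannel g → Normalises g f → Normalises g f′)

  record Normalisation : Set (o ⊔ ℓ) where
    field
      norm : ∀ {X Y} → Hom X Y → Hom X Y
      norm-partial : ∀ {X Y} (f : Hom X Y) → PartialChannel (norm f)
      norm-normalises : ∀ {X Y} (f : Hom X Y) → Normalises (norm f) f
      N1 : ∀ {X Y} (f : Hom X Y) → PartialChannel f → norm f ≡ f
      N2 : ∀ {X Y Z W} (f : Hom X Y) (g : Hom Z W) →
           norm (f ⊗₁ g) ≡ norm f ⊗₁ norm g
      N3 : ∀ {X Y} (f : Hom X Y) → norm (ε {Y} ∘ f) ≡ ε {Y} ∘ norm f
      N4 : ∀ {X Y} (f : Hom (X ⊗₀ X) Y) → norm (f ∘ Δ {X}) ≡ norm f ∘ Δ {X}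

{-# OPTIONS --safe #-}
-- Under the isomorphism ρ⇐ : Y ≅ Y ⊗ I, the normalising equation for g and f
-- reads  ρ⇐ ∘ f ≡ (g ⊗ (ε ∘ f)) ∘ Δ.  Since ρ⇐ ∘ h is itself the copy-discard
-- composite (h ⊗ ε) ∘ Δ, the axioms N1–N4 show that norm commutes with
-- ρ⇐ ∘ _, so applying norm to both sides of that equation turns f into
-- norm f and fixes the partial channel g.
module Submission where

open import Defs
open import Level using (Level)
open import Data.Product using (_,_)
open import Relation.Binary.PropositionalEquality

module CDCategoryProperties {o ℓ : Level} (C : CDCategory o ℓ) where
  open CDCategory C
  open ≡-Reasoning

  ρ⇐∘ρ⇒∘ : ∀ {X Y} (k : Hom X (Y ⊗₀ I)) → ρ⇐ ∘ ρ⇒ ∘ k ≡ k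
  ρ⇐∘ρ⇒∘ k = begin
    ρ⇐ ∘ ρ⇒ ∘ k   ≡⟨ assoc _ _ _ ⟨
    (ρ⇐ ∘ ρ⇒) ∘ k ≡⟨ cong (_∘ k) ρ-isoˡ ⟩
    id ∘ k        ≡⟨ identityˡ k ⟩
    k             ∎

  ρ⇐-transpose : ∀ {X Y} {f : Hom X Y} {k : Hom X (Y ⊗₀ I)} → f ≡ ρ⇒ ∘ k → ρ⇐ ∘ f ≡ k
  ρ⇐-transpose {k = k} refl = ρ⇐∘ρ⇒∘ k

  ρ⇒-transpose : ∀ {X Y} {f : Hom X Y} {k : Hom X (Y ⊗₀ I)} → ρ⇐ ∘ f ≡ k → f ≡ ρ⇒ ∘ k
  ρ⇒-transpose {f = f} refl = begin
    f              ≡⟨ identityˡ f ⟨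
    id ∘ f         ≡⟨ cong (_∘ f) ρ-isoʳ ⟨
    (ρ⇒ ∘ ρ⇐) ∘ f  ≡⟨ assoc _ _ _ ⟩
    ρ⇒ ∘ ρ⇐ ∘ f    ∎

  ⊗id∘id⊗ : ∀ {A B C D} (h : Hom A B) (k : Hom C D) → (h ⊗₁ id) ∘ (id ⊗₁ k) ≡ h ⊗₁ k
  ⊗id∘id⊗ h k = begin
    (h ⊗₁ id) ∘ (id ⊗₁ k)  ≡⟨ ⊗-∘ h id id k ⟨
    (h ∘ id) ⊗₁ (id ∘ k)   ≡⟨ cong₂ _⊗₁_ (identityʳ h) (identityˡ k) ⟩
    h ⊗₁ k                 ∎

  -- The counit law, transported along the naturality of ρ⇒.
  ρ⇐∘≡copy-discard : ∀ {X Y} (h : Hom X Y) → ρ⇐ ∘ h ≡ (h ⊗₁ ε) ∘ Δ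
  ρ⇐∘≡copy-discard h = begin
    ρ⇐ ∘ h                                ≡⟨ cong (ρ⇐ ∘_) (identityʳ h) ⟨
    ρ⇐ ∘ h ∘ id                           ≡⟨ cong (λ u → ρ⇐ ∘ h ∘ u) Δ-counitʳ ⟨
    ρ⇐ ∘ h ∘ ρ⇒ ∘ (id ⊗₁ ε) ∘ Δ           ≡⟨ cong (ρ⇐ ∘_) (assoc _ _ _) ⟨
    ρ⇐ ∘ (h ∘ ρ⇒) ∘ (id ⊗₁ ε) ∘ Δ         ≡⟨ cong (λ u → ρ⇐ ∘ u ∘ (id ⊗₁ ε) ∘ Δ) (ρ-natural h) ⟨
    ρ⇐ ∘ (ρ⇒ ∘ (h ⊗₁ id)) ∘ (id ⊗₁ ε) ∘ Δ ≡⟨ cong (ρ⇐ ∘_) (assoc _ _ _) ⟩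
    ρ⇐ ∘ ρ⇒ ∘ (h ⊗₁ id) ∘ (id ⊗₁ ε) ∘ Δ   ≡⟨ ρ⇐∘ρ⇒∘ _ ⟩
    (h ⊗₁ id) ∘ (id ⊗₁ ε) ∘ Δ             ≡⟨ assoc _ _ _ ⟨
    ((h ⊗₁ id) ∘ (id ⊗₁ ε)) ∘ Δ           ≡⟨ cong (_∘ Δ) (⊗id∘id⊗ h ε) ⟩
    (h ⊗₁ ε) ∘ Δ                          ∎

  id-partialChannel : ∀ {X} → PartialChannel C (id {X})
  id-partialChannel = begin
    id                          ≡⟨ Δ-counitʳ ⟨
    ρ⇒ ∘ (id ⊗₁ ε) ∘ Δ          ≡⟨ cong (λ u → ρ⇒ ∘ (id ⊗₁ u) ∘ Δ) (identityʳ ε) ⟨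
    ρ⇒ ∘ (id ⊗₁ (ε ∘ id)) ∘ Δ   ∎

module NormalisationProperties {o ℓ : Level} (C : CDCategory o ℓ) (N : Normalisation C) where
  open CDCategory C
  open Normalisation N
  open CDCategoryProperties C
  open ≡-Reasoning

  norm-id : ∀ {X} → norm (id {X}) ≡ id
  norm-id = N1 id id-partialChannel

  norm-ε : ∀ {X} → norm (ε {X}) ≡ ε
  norm-ε = begin
    norm ε         ≡⟨ cong norm (identityʳ ε) ⟨
    norm (ε ∘ id)  ≡⟨ N3 id ⟩
    ε ∘ norm id    ≡⟨ cong (ε ∘_) norm-id ⟩
    ε ∘ id         ≡⟨ identityʳ ε ⟩
    ε              ∎

  norm-copy-tensor : ∀ {X Y Z} (g : Hom X Y) (h : Hom X Z) →
                     norm ((g ⊗₁ h) ∘ Δ) ≡ (norm g ⊗₁ norm h) ∘ Δ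
  norm-copy-tensor g h = trans (N4 (g ⊗₁ h)) (cong (_∘ Δ) (N2 g h))

  norm-ρ⇐∘ : ∀ {X Y} (h : Hom X Y) → norm (ρ⇐ ∘ h) ≡ ρ⇐ ∘ norm h
  norm-ρ⇐∘ h = begin
    norm (ρ⇐ ∘ h)            ≡⟨ cong norm (ρ⇐∘≡copy-discard h) ⟩
    norm ((h ⊗₁ ε) ∘ Δ)      ≡⟨ norm-copy-tensor h ε ⟩
    (norm h ⊗₁ norm ε) ∘ Δ   ≡⟨ cong (λ u → (norm h ⊗₁ u) ∘ Δ) norm-ε ⟩
    (norm h ⊗₁ ε) ∘ Δ        ≡⟨ ρ⇐∘≡copy-discard (norm h) ⟨
    ρ⇐ ∘ norm h              ∎

  norm-minimal : ∀ {X Y} (f g : Hom X Y) → PartialChannel C g → Normalises C g f →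
                 Normalises C g (norm f)
  norm-minimal f g g-partial g-normalises-f = ρ⇒-transpose (begin
    ρ⇐ ∘ norm f                    ≡⟨ norm-ρ⇐∘ f ⟨
    norm (ρ⇐ ∘ f)                  ≡⟨ cong norm (ρ⇐-transpose g-normalises-f) ⟩
    norm ((g ⊗₁ (ε ∘ f)) ∘ Δ)      ≡⟨ norm-copy-tensor g (ε ∘ f) ⟩
    (norm g ⊗₁ norm (ε ∘ f)) ∘ Δ   ≡⟨ cong₂ (λ a b → (a ⊗₁ b) ∘ Δ) (N1 g g-partial) (N3 f) ⟩
    (g ⊗₁ (ε ∘ norm f)) ∘ Δ        ∎)

propositionB4 : ∀ {o ℓ : Level} (C : CDCategory o ℓ) (N : Normalisation C) →
    ∀ {X Y} (f : CDCategory.Hom C X Y) →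
    IsMinimalNormalisation C f (Normalisation.norm N f)
propositionB4 C N f =
  norm-partial f , norm-normalises f , λ g → norm-minimal f g
  where
  open Normalisation N
  open NormalisationProperties C N
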